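{- Let $k\ge1$ and let $\mu=(\mu_1,\dots,\mu_k)$ be a composition of $2k+1$ into $k$ parts. Then there are exactly $\binom{2k+1}{k-1}$ plane trees $T$ with exactly $k$ leaves whose extended leaf length sequence $(\ell_1,\dots,\ell_k)$ is a cyclic shift of $\mu$.
   Context: A plane tree is a rooted tree in which the children of each vertex are linearly ordered (left to right). A leaf is a non-root vertex with no children. Let $T$ have leaves $v_1,\dots,v_k$ in left-to-right order. For each $i$, starting at $v_i$, walk toward the root and stop at the first vertex $a$ such that the walk arrived at $a$ from a child of $a$ that is not the leftmost child of $a$ (i.e. $a$ has another child to the left of the path); if no such vertex exists, $a$ is the root. The path from $v_i$ to $a$ is the extended leaf $E_i$, and $\ell_i$ is its number of edges. The sequence $(\ell_1,\dots,\ell_k)$ is the extended leaf length sequence of $T$. A cyclic shift of $(p_1,\dots,p_k)$ is a sequence $(p_i,\dots,p_k,p_1,\dots,p_{i-1})$. -}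

module Defs where

open import Data.Nat using (ℕ; zero; suc; _+_; _<_)
open import Data.List using (List; []; _∷_; _++_; take; drop; length)
open import Data.Product using (∃; _×_)
open import Relation.Binary.PropositionalEquality using (_≡_)

data PTree : Set where
  node : List PTree → PTree

-- Number of leaves (non-root vertices with no children).
-- leavesSub t : leaves of t, viewing the root of t as a NON-root vertex.
mutual
  leavesSub : PTree → ℕ
  leavesSub (node [])       = 1
  leavesSub (node (c ∷ cs)) = leavesL (c ∷ cs)

  leavesL : List PTree → ℕ
  leavesL []       = 0
  leavesL (c ∷ cs) = leavesSub c + leavesL cs

leaves : PTree → ℕ
leaves (node cs) = leavesL cs

incHead : List ℕ → List ℕ
incHead []       = []
incHead (x ∷ xs) = suc x ∷ xs

-- ext t (t a non-root subtree): the extended leaf lengths of the leaves of t,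
-- left to right, where the first entry (the leftmost leaf, whose walk climbs
-- only through leftmost children) is measured only up to the root of t
-- (its walk is still "open"); all other entries are complete, since their
-- walks stop inside t.
-- extL cs : for children cs of a vertex a: the walk from child c_1's open
-- leaf passes the edge to a (arriving from the leftmost child, so continues
-- if a is not the root, stops if a is the root); the open leaf of each c_j,
-- j ≥ 2, passes the edge to a and stops at a.
mutual
  ext : PTree → List ℕ
  ext (node [])       = 0 ∷ []
  ext (node (c ∷ cs)) = extL (c ∷ cs)

  extL : List PTree → List ℕ
  extL []       = []
  extL (c ∷ cs) = incHead (ext c) ++ extL cs

extLeafLengths : PTree → List ℕ
extLeafLengths (node cs) = extL cs

IsCyclicShift : List ℕ → List ℕ → Set
IsCyclicShift p q = ∃ λ i → i < length q × p ≡ drop i q ++ take i q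

-- Record a plane tree with leaves v₁ … v_k by the pairs (ℓᵢ , eᵢ), where eᵢ is the number of edges from vᵢ
-- up to the vertex where the next extended leaf stops (from v_k: up to one above the root).  The depths of
-- these stopping vertices are the partial sums of ℓᵢ − eᵢ, so this is a bijection onto the sequences of
-- positive pairs with Σ e = Σ ℓ + 1 in which no proper prefix has Σ e > Σ ℓ.  When ℓ is a cyclic shift of
-- μ, Σ ℓ = 2k + 1 and e is a composition of 2k + 2 into k parts.  Conversely, for such a composition e the
-- cycle lemma gives exactly one rotation of the pairs (μᵢ , eᵢ) with the prefix property (cut after the
-- shortest prefix with maximal Σ e − Σ ℓ), and since gcd (k , 2k + 1) = 1 distinct rotations of μ are
-- distinct.  So the trees correspond to the C(2k+1, k−1) compositions of 2k + 2 into k parts.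

module Submission where

open import Defs
open import Data.Nat using (ℕ; zero; suc; >-nonZero; _+_; _*_; _∸_; _≤_; _<_; s≤s; z≤n; z<s; _≤?_)
open import Data.Nat.Properties
open import Data.Nat.Combinatorics using (_C_; nCk+nC[k+1]≡[n+1]C[k+1])
open import Data.Nat.Coprimality using (Coprime; coprime-divisor; coprime-+; 1-coprimeTo)
import Data.Nat.Coprimality as Coprimality
open import Data.Nat.Divisibility using (_∣_; ∣⇒≤; m∣m*n)
open import Data.Nat.ListAction using (sum)
open import Data.Nat.ListAction.Properties using (sum-++; sum-↭)
open import Data.Nat.Tactic.RingSolver using (solve-∀)
open import Data.List using (List; []; _∷_; _++_; length; map; take; drop; zip)
open import Data.List.Properties
  using (length-map; length-++; length-take; length-drop; map-++; take-map; drop-map; take-[]; take-all; drop-all;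
         take-take; drop-drop; take++drop≡id; ++-assoc; ++-cancelˡ; ++-identityʳ)
open import Data.List.Relation.Unary.All using (All; []; _∷_)
import Data.List.Relation.Unary.All.Properties as Allₚ
open import Data.List.Relation.Unary.Any using (here; there)
open import Data.List.Relation.Unary.AllPairs using ([]; _∷_)
open import Data.List.Relation.Unary.Unique.Propositional using (Unique)
import Data.List.Relation.Unary.Unique.Propositional.Properties as Uniqueₚ
import Data.List.Relation.Binary.Permutation.Propositional.Properties as Permₚ
open import Data.List.Membership.Propositional using (_∈_)
open import Data.List.Membership.Propositional.Properties using (∈-++⁻; ∈-++⁺ˡ; ∈-++⁺ʳ; ∈-map⁺; ∈-map⁻)
open import Data.Product using (Σ; ∃; _×_; _,_; proj₁; proj₂)
open import Data.Sum using (inj₁; inj₂)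
open import Data.Empty using (⊥-elim)
open import Function using (_∘_; _$_)
open import Function.Bundles using (_⇔_; mk⇔; Equivalence)
open import Relation.Nullary using (¬_; yes; no)
open import Relation.Binary.Definitions using (tri<; tri≈; tri>)
open import Relation.Binary.PropositionalEquality

open Equivalence using (to; from)

rotate : {A : Set} → ℕ → List A → List A
rotate s xs = drop s xs ++ take s xs

prefixSum : {A : Set} → (A → ℕ) → ℕ → List A → ℕ
prefixSum f j xs = sum (map f (take j xs))

module _ {A : Set} where

  take-++ˡ : ∀ j (xs ys : List A) → j ≤ length xs → take j (xs ++ ys) ≡ take j xs
  take-++ˡ zero    xs       ys _         = refl
  take-++ˡ (suc j) (x ∷ xs) ys (s≤s j≤) = cong (x ∷_) (take-++ˡ j xs ys j≤)

  drop-++ˡ : ∀ j (xs ys : List A) → j ≤ length xs → drop j (xs ++ ys) ≡ drop j xs ++ ys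
  drop-++ˡ zero    xs       ys _         = refl
  drop-++ˡ (suc j) (x ∷ xs) ys (s≤s j≤) = drop-++ˡ j xs ys j≤

  take-length-++ : ∀ (xs ys : List A) t → take (length xs + t) (xs ++ ys) ≡ xs ++ take t ys
  take-length-++ []       ys t = refl
  take-length-++ (x ∷ xs) ys t = cong (x ∷_) (take-length-++ xs ys t)

  take-+ : ∀ m n (xs : List A) → take (m + n) xs ≡ take m xs ++ take n (drop m xs)
  take-+ zero    n xs       = refl
  take-+ (suc m) n []       = sym (take-[] n)
  take-+ (suc m) n (x ∷ xs) = cong (x ∷_) (take-+ m n xs)

  length-take-≤ : ∀ n (xs : List A) → n ≤ length xs → length (take n xs) ≡ n
  length-take-≤ n xs n≤ = trans (length-take n xs) (m≤n⇒m⊓n≡m n≤)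

  length-rotate : ∀ s (xs : List A) → s ≤ length xs → length (rotate s xs) ≡ length xs
  length-rotate s xs s≤ = begin
    length (drop s xs ++ take s xs)         ≡⟨ length-++ (drop s xs) ⟩
    length (drop s xs) + length (take s xs) ≡⟨ cong₂ _+_ (length-drop s xs) (length-take-≤ s xs s≤) ⟩
    length xs ∸ s + s                       ≡⟨ m∸n+n≡m s≤ ⟩
    length xs                               ∎
    where open ≡-Reasoning

  rotate-length : ∀ (xs : List A) → rotate (length xs) xs ≡ xs
  rotate-length xs = cong₂ _++_ (drop-all (length xs) xs ≤-refl) (take-all (length xs) xs ≤-refl)

  rotate-rotate : ∀ s r (xs : List A) → s + r ≤ length xs → rotate r (rotate s xs) ≡ rotate (s + r) xs
  rotate-rotate s r xs s+r≤ = begin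
    drop r (drop s xs ++ take s xs) ++ take r (drop s xs ++ take s xs)
      ≡⟨ cong₂ _++_ (drop-++ˡ r (drop s xs) (take s xs) r≤) (take-++ˡ r (drop s xs) (take s xs) r≤) ⟩
    (drop r (drop s xs) ++ take s xs) ++ take r (drop s xs)
      ≡⟨ ++-assoc (drop r (drop s xs)) (take s xs) (take r (drop s xs)) ⟩
    drop r (drop s xs) ++ (take s xs ++ take r (drop s xs))
      ≡⟨ cong₂ _++_ (drop-drop s r xs) (sym (take-+ s r xs)) ⟩
    drop (s + r) xs ++ take (s + r) xs ∎
    where
    open ≡-Reasoning
    r≤ : r ≤ length (drop s xs)
    r≤ = subst (r ≤_) (sym (length-drop s xs))
           (subst (_≤ length xs ∸ s) (m+n∸m≡n s r) (∸-monoˡ-≤ s s+r≤))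

  rotate-∸-rotate : ∀ s (xs : List A) → s ≤ length xs → rotate (length xs ∸ s) (rotate s xs) ≡ xs
  rotate-∸-rotate s xs s≤ = begin
    rotate (length xs ∸ s) (rotate s xs) ≡⟨ rotate-rotate s _ xs (≤-reflexive (m+[n∸m]≡n s≤)) ⟩
    rotate (s + (length xs ∸ s)) xs      ≡⟨ cong (λ n → rotate n xs) (m+[n∸m]≡n s≤) ⟩
    rotate (length xs) xs                ≡⟨ rotate-length xs ⟩
    xs                                   ∎
    where open ≡-Reasoning

  rotate-rotate-∸ : ∀ s (xs : List A) → s ≤ length xs → rotate s (rotate (length xs ∸ s) xs) ≡ xs
  rotate-rotate-∸ s xs s≤ = begin
    rotate s (rotate (length xs ∸ s) xs) ≡⟨ rotate-rotate _ s xs (≤-reflexive (m∸n+n≡m s≤)) ⟩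
    rotate (length xs ∸ s + s) xs        ≡⟨ cong (λ n → rotate n xs) (m∸n+n≡m s≤) ⟩
    rotate (length xs) xs                ≡⟨ rotate-length xs ⟩
    xs                                   ∎
    where open ≡-Reasoning

  All-rotate : ∀ {P : A → Set} s {xs : List A} → All P xs → All P (rotate s xs)
  All-rotate s p = Allₚ.++⁺ (Allₚ.drop⁺ s p) (Allₚ.take⁺ s p)

map-rotate : ∀ {A B : Set} (f : A → B) s xs → map f (rotate s xs) ≡ rotate s (map f xs)
map-rotate f s xs = trans (map-++ f (drop s xs) (take s xs))
                          (sym (cong₂ _++_ (drop-map s xs) (take-map s xs)))

sum-rotate : ∀ s xs → sum (rotate s xs) ≡ sum xs
sum-rotate s xs = trans (sum-↭ (Permₚ.++-comm (drop s xs) (take s xs))) (cong sum (take++drop≡id s xs))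

sum-map-rotate : ∀ {A : Set} (f : A → ℕ) s xs → sum (map f (rotate s xs)) ≡ sum (map f xs)
sum-map-rotate f s xs = trans (cong sum (map-rotate f s xs)) (sum-rotate s (map f xs))

sum-map-++ : ∀ {A : Set} (f : A → ℕ) xs ys → sum (map f (xs ++ ys)) ≡ sum (map f xs) + sum (map f ys)
sum-map-++ f xs ys = trans (cong sum (map-++ f xs ys)) (sum-++ (map f xs) (map f ys))

map-proj₁-zip : ∀ {A B : Set} (xs : List A) (ys : List B) → length xs ≡ length ys → map proj₁ (zip xs ys) ≡ xs
map-proj₁-zip []       []       _   = refl
map-proj₁-zip (x ∷ xs) (y ∷ ys) len = cong (x ∷_) (map-proj₁-zip xs ys (suc-injective len))

map-proj₂-zip : ∀ {A B : Set} (xs : List A) (ys : List B) → length xs ≡ length ys → map proj₂ (zip xs ys) ≡ ys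
map-proj₂-zip []       []       _   = refl
map-proj₂-zip (x ∷ xs) (y ∷ ys) len = cong (y ∷_) (map-proj₂-zip xs ys (suc-injective len))

zip-map-proj : ∀ {A B : Set} (xys : List (A × B)) → zip (map proj₁ xys) (map proj₂ xys) ≡ xys
zip-map-proj []        = refl
zip-map-proj (xy ∷ xys) = cong (xy ∷_) (zip-map-proj xys)

Unique-map⁺ : ∀ {A B : Set} (f : A → B) {xs : List A} →
              (∀ {x y} → x ∈ xs → y ∈ xs → f x ≡ f y → x ≡ y) → Unique xs → Unique (map f xs)
Unique-map⁺ f {[]}     _   _              = []
Unique-map⁺ f {x ∷ xs} inj (x∉xs ∷ xs!) =
  distinct x∉xs (λ y∈ → inj (here refl) (there y∈)) ∷ Unique-map⁺ f (λ y∈ z∈ → inj (there y∈) (there z∈)) xs!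
  where
  distinct : ∀ {ys} → All (x ≢_) ys → (∀ {y} → y ∈ ys → f x ≡ f y → x ≡ y) → All (f x ≢_) (map f ys)
  distinct []             _   = []
  distinct (x≢y ∷ x≢ys) inj′ = (λ fx≡fy → x≢y (inj′ (here refl) fx≡fy)) ∷ distinct x≢ys (inj′ ∘ there)

module _ {A : Set} (f : A → ℕ) (xs : List A) where

  prefixSum-rotate : ∀ s j → j ≤ length xs ∸ s →
                     prefixSum f j (rotate s xs) + prefixSum f s xs ≡ prefixSum f (s + j) xs
  prefixSum-rotate s j j≤ = begin
    prefixSum f j (rotate s xs) + prefixSum f s xs
      ≡⟨ cong (λ ys → sum (map f ys) + prefixSum f s xs) (take-++ˡ j (drop s xs) (take s xs) j≤′) ⟩
    sum (map f (take j (drop s xs))) + prefixSum f s xs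
      ≡⟨ +-comm _ (prefixSum f s xs) ⟩
    prefixSum f s xs + sum (map f (take j (drop s xs)))
      ≡⟨ sym (sum-map-++ f (take s xs) (take j (drop s xs))) ⟩
    sum (map f (take s xs ++ take j (drop s xs)))
      ≡⟨ cong (λ ys → sum (map f ys)) (sym (take-+ s j xs)) ⟩
    prefixSum f (s + j) xs ∎
    where
    open ≡-Reasoning
    j≤′ : j ≤ length (drop s xs)
    j≤′ = subst (j ≤_) (sym (length-drop s xs)) j≤

  prefixSum-rotate-wrap : ∀ s t → t ≤ s →
    prefixSum f (length xs ∸ s + t) (rotate s xs) + prefixSum f s xs ≡ sum (map f xs) + prefixSum f t xs
  prefixSum-rotate-wrap s t t≤s = begin
    prefixSum f (length xs ∸ s + t) (rotate s xs) + S
      ≡⟨ cong (λ n → prefixSum f (n + t) (rotate s xs) + S) (sym (length-drop s xs)) ⟩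
    sum (map f (take (length (drop s xs) + t) (drop s xs ++ take s xs))) + S
      ≡⟨ cong (λ ys → sum (map f ys) + S) (take-length-++ (drop s xs) (take s xs) t) ⟩
    sum (map f (drop s xs ++ take t (take s xs))) + S
      ≡⟨ cong (λ ys → sum (map f (drop s xs ++ ys)) + S) take-take-≤ ⟩
    sum (map f (drop s xs ++ take t xs)) + S
      ≡⟨ cong (_+ S) (sum-map-++ f (drop s xs) (take t xs)) ⟩
    (D + T) + S
      ≡⟨ +-comm (D + T) S ⟩
    S + (D + T)
      ≡⟨ sym (+-assoc S D T) ⟩
    (S + D) + T
      ≡⟨ cong (_+ T) (sym (sum-map-++ f (take s xs) (drop s xs))) ⟩
    sum (map f (take s xs ++ drop s xs)) + T
      ≡⟨ cong (λ ys → sum (map f ys) + T) (take++drop≡id s xs) ⟩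
    sum (map f xs) + T ∎
    where
    open ≡-Reasoning
    D = sum (map f (drop s xs))
    T = prefixSum f t xs
    S = prefixSum f s xs
    take-take-≤ : take t (take s xs) ≡ take t xs
    take-take-≤ = trans (take-take t s xs) (cong (λ n → take n xs) (m≤n⇒m⊓n≡m t≤s))

-- Aperiodicity

commute⇒prefix : ∀ {A : Set} (xs ys : List A) → length xs ≤ length ys → xs ++ ys ≡ ys ++ xs →
                 ys ≡ xs ++ drop (length xs) ys
commute⇒prefix xs ys xs≤ys eq = begin
  ys                                             ≡⟨ sym (take++drop≡id (length xs) ys) ⟩
  take (length xs) ys ++ drop (length xs) ys     ≡⟨ cong (_++ drop (length xs) ys) take≡xs ⟩
  xs ++ drop (length xs) ys                      ∎
  where
  open ≡-Reasoning
  take≡xs : take (length xs) ys ≡ xs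
  take≡xs = begin
    take (length xs) ys         ≡⟨ sym (take-++ˡ (length xs) ys xs xs≤ys) ⟩
    take (length xs) (ys ++ xs) ≡⟨ cong (take (length xs)) (sym eq) ⟩
    take (length xs) (xs ++ ys) ≡⟨ take-++ˡ (length xs) xs ys ≤-refl ⟩
    take (length xs) xs         ≡⟨ take-all (length xs) xs ≤-refl ⟩
    xs                          ∎

commute-++-cancel : ∀ {A : Set} (xs zs : List A) → xs ++ (xs ++ zs) ≡ (xs ++ zs) ++ xs → xs ++ zs ≡ zs ++ xs
commute-++-cancel xs zs eq = ++-cancelˡ xs (xs ++ zs) (zs ++ xs) (trans eq (++-assoc xs zs xs))

proportional-++ : ∀ (xs zs : List ℕ) → length zs * sum xs ≡ length xs * sum zs →
                  length (xs ++ zs) * sum xs ≡ length xs * sum (xs ++ zs)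
proportional-++ xs zs eq = begin
  length (xs ++ zs) * sum xs                ≡⟨ cong (_* sum xs) (length-++ xs) ⟩
  (length xs + length zs) * sum xs          ≡⟨ *-distribʳ-+ (sum xs) (length xs) (length zs) ⟩
  length xs * sum xs + length zs * sum xs   ≡⟨ cong (length xs * sum xs +_) eq ⟩
  length xs * sum xs + length xs * sum zs   ≡⟨ sym (*-distribˡ-+ (length xs) (sum xs) (sum zs)) ⟩
  length xs * (sum xs + sum zs)             ≡⟨ cong (length xs *_) (sym (sum-++ xs zs)) ⟩
  length xs * sum (xs ++ zs)                ∎
  where open ≡-Reasoning

commute⇒proportional : ∀ (xs ys : List ℕ) → xs ++ ys ≡ ys ++ xs → length ys * sum xs ≡ length xs * sum ys
commute⇒proportional xs ys = go (length xs + length ys) xs ys ≤-refl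
  where
  mutual
    go : ∀ n xs ys → length xs + length ys ≤ n → xs ++ ys ≡ ys ++ xs →
         length ys * sum xs ≡ length xs * sum ys
    go n       []       ys _ _ = *-zeroʳ (length ys)
    go n       xs       [] _ _ = sym (*-zeroʳ (length xs))
    go zero    (_ ∷ _) (_ ∷ _) () _
    go (suc n) xs@(_ ∷ _) ys@(_ ∷ _) bound eq with length xs ≤? length ys
    ... | yes xs≤ys = shorter-first n xs ys xs≤ys bound eq
    ... | no  xs≰ys = sym (shorter-first n ys xs (≰⇒≥ xs≰ys)
                            (subst (_≤ suc n) (+-comm (length xs) (length ys)) bound) (sym eq))

    shorter-first : ∀ n xs ys → length xs ≤ length ys → length xs + length ys ≤ suc n →
                    xs ++ ys ≡ ys ++ xs → length ys * sum xs ≡ length xs * sum ys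
    shorter-first n [] ys _ _ _ = *-zeroʳ (length ys)
    shorter-first n xs@(_ ∷ _) ys xs≤ys bound eq =
      subst (λ ys → length ys * sum xs ≡ length xs * sum ys) (sym ys≡)
        (proportional-++ xs zs
          (go n xs zs bound′ (commute-++-cancel xs zs (subst (λ ys → xs ++ ys ≡ ys ++ xs) ys≡ eq))))
      where
      zs = drop (length xs) ys
      ys≡ : ys ≡ xs ++ zs
      ys≡ = commute⇒prefix xs ys xs≤ys eq
      bound′ : length xs + length zs ≤ n
      bound′ = ≤-pred $ begin-strict
        length xs + length zs        ≡⟨ cong (length xs +_) (length-drop (length xs) ys) ⟩
        length xs + (length ys ∸ length xs) ≡⟨ m+[n∸m]≡n xs≤ys ⟩
        length ys                    <⟨ m<n+m (length ys) z<s ⟩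
        length xs + length ys        ≤⟨ bound ⟩
        suc n                        ∎
        where open ≤-Reasoning

rotate-aperiodic : ∀ (xs : List ℕ) → Coprime (length xs) (sum xs) →
                   ∀ r → 0 < r → r < length xs → rotate r xs ≢ xs
rotate-aperiodic xs coprime r 0<r r<k fixed = <⇒≱ r<k (∣⇒≤ ⦃ >-nonZero 0<r ⦄ k∣r)
  where
  k = length xs
  before = take r xs
  after  = drop r xs
  commute : before ++ after ≡ after ++ before
  commute = trans (take++drop≡id r xs) (sym fixed)
  k*Σbefore : k * sum before ≡ sum xs * r
  k*Σbefore = begin
    k * sum before                            ≡⟨ cong (_* sum before) (sym (m∸n+n≡m (<⇒≤ r<k))) ⟩
    (k ∸ r + r) * sum before                  ≡⟨ *-distribʳ-+ (sum before) (k ∸ r) r ⟩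
    (k ∸ r) * sum before + r * sum before     ≡⟨ cong₂ (λ a b → a * sum before + b * sum before)
                                                   (sym (length-drop r xs)) (sym |before|) ⟩
    length after * sum before + length before * sum before
                                              ≡⟨ cong (_+ length before * sum before)
                                                   (commute⇒proportional before after commute) ⟩
    length before * sum after + length before * sum before
                                              ≡⟨ sym (*-distribˡ-+ (length before) (sum after) (sum before)) ⟩
    length before * (sum after + sum before)  ≡⟨ cong₂ _*_ |before| (+-comm (sum after) (sum before)) ⟩
    r * (sum before + sum after)              ≡⟨ cong (r *_) (sym (sum-++ before after)) ⟩
    r * sum (before ++ after)                 ≡⟨ cong (λ ys → r * sum ys) (take++drop≡id r xs) ⟩
    r * sum xs                                ≡⟨ *-comm r (sum xs) ⟩
    sum xs * r                                ∎
    where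
    open ≡-Reasoning
    |before| : length before ≡ r
    |before| = length-take-≤ r xs (<⇒≤ r<k)
  k∣r : k ∣ r
  k∣r = coprime-divisor coprime (subst (k ∣_) k*Σbefore (m∣m*n (sum before)))

rotate-distinct : ∀ (xs : List ℕ) → Coprime (length xs) (sum xs) →
                  ∀ {s s′} → s < s′ → s′ < length xs → rotate s xs ≢ rotate s′ xs
rotate-distinct xs coprime {s} {s′} s<s′ s′<k eq =
  rotate-aperiodic ys coprime′ (s′ ∸ s) (m<n⇒0<n∸m s<s′) r<|ys| fixed
  where
  ys = rotate s xs
  s≤k : s ≤ length xs
  s≤k = <⇒≤ (<-trans s<s′ s′<k)
  |ys| : length ys ≡ length xs
  |ys| = length-rotate s xs s≤k
  coprime′ : Coprime (length ys) (sum ys)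
  coprime′ = subst₂ Coprime (sym |ys|) (sym (sum-rotate s xs)) coprime
  r<|ys| : s′ ∸ s < length ys
  r<|ys| = subst (s′ ∸ s <_) (sym |ys|) (≤-<-trans (m∸n≤m s′ s) s′<k)
  fixed : rotate (s′ ∸ s) ys ≡ ys
  fixed = begin
    rotate (s′ ∸ s) (rotate s xs) ≡⟨ rotate-rotate s (s′ ∸ s) xs (≤-trans (≤-reflexive s+r≡s′) (<⇒≤ s′<k)) ⟩
    rotate (s + (s′ ∸ s)) xs      ≡⟨ cong (λ n → rotate n xs) s+r≡s′ ⟩
    rotate s′ xs                  ≡⟨ sym eq ⟩
    rotate s xs                   ∎
    where
    open ≡-Reasoning
    s+r≡s′ : s + (s′ ∸ s) ≡ s′
    s+r≡s′ = m+[n∸m]≡n (<⇒≤ s<s′)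

rotate-injective : ∀ (xs : List ℕ) → Coprime (length xs) (sum xs) →
                   ∀ {s s′} → s < length xs → s′ < length xs → rotate s xs ≡ rotate s′ xs → s ≡ s′
rotate-injective xs coprime {s} {s′} s<k s′<k eq with <-cmp s s′
... | tri< s<s′ _ _ = ⊥-elim (rotate-distinct xs coprime s<s′ s′<k eq)
... | tri≈ _ s≡s′ _ = s≡s′
... | tri> _ _ s′<s = ⊥-elim (rotate-distinct xs coprime s′<s s<k (sym eq))

coprime-n-2n+1 : ∀ n → Coprime n (2 * n + 1)
coprime-n-2n+1 n = Coprimality.sym (subst (λ m → Coprime m n) (solve n) (coprime-+ (coprime-+ (1-coprimeTo n))))
  where
  solve : ∀ n → n + (n + 1) ≡ 2 * n + 1
  solve = solve-∀

-- Compositions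

Positive : List ℕ → Set
Positive = All (λ m → 1 ≤ m)

IsComposition : ℕ → ℕ → List ℕ → Set
IsComposition n k xs = length xs ≡ k × Positive xs × sum xs ≡ n

compositions : ℕ → ℕ → List (List ℕ)
compositions zero    zero    = [] ∷ []
compositions zero    (suc k) = []
compositions (suc n) zero    = []
compositions (suc n) (suc k) = map (1 ∷_) (compositions n k) ++ map incHead (compositions n (suc k))

length-compositions : ∀ n k → length (compositions (suc n) (suc k)) ≡ n C k
length-compositions zero    zero    = refl
length-compositions zero    (suc k) = refl
length-compositions (suc n) k = begin
  length (map (1 ∷_) (compositions (suc n) k) ++ map incHead (compositions (suc n) (suc k)))
    ≡⟨ length-++ (map (1 ∷_) (compositions (suc n) k)) ⟩
  length (map (1 ∷_) (compositions (suc n) k)) + length (map incHead (compositions (suc n) (suc k)))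
    ≡⟨ cong₂ _+_ (length-map (1 ∷_) (compositions (suc n) k))
                 (length-map incHead (compositions (suc n) (suc k))) ⟩
  length (compositions (suc n) k) + length (compositions (suc n) (suc k))
    ≡⟨ by-k k ⟩
  suc n C k ∎
  where
  open ≡-Reasoning
  by-k : ∀ k → length (compositions (suc n) k) + length (compositions (suc n) (suc k)) ≡ suc n C k
  by-k zero    = length-compositions n zero
  by-k (suc k) = trans (cong₂ _+_ (length-compositions n k) (length-compositions n (suc k)))
                       (nCk+nC[k+1]≡[n+1]C[k+1] n k)

∈-compositions⁻ : ∀ n k {xs} → xs ∈ compositions n k → IsComposition n k xs
∈-compositions⁻ zero    zero    (here refl) = refl , [] , refl
∈-compositions⁻ (suc n) (suc k) {xs} xs∈ with ∈-++⁻ (map (1 ∷_) (compositions n k)) xs∈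
... | inj₁ xs∈₁ with ∈-map⁻ (1 ∷_) xs∈₁
...   | ys , ys∈ , refl with ∈-compositions⁻ n k ys∈
...     | len , pos , total = cong suc len , s≤s z≤n ∷ pos , cong suc total
∈-compositions⁻ (suc n) (suc k) {xs} xs∈ | inj₂ xs∈₂ with ∈-map⁻ incHead xs∈₂
... | ys , ys∈ , refl with ∈-compositions⁻ n (suc k) ys∈
... | len , pos , total = enlarged ys len pos total
  where
  enlarged : ∀ ys → length ys ≡ suc k → Positive ys → sum ys ≡ n → IsComposition (suc n) (suc k) (incHead ys)
  enlarged (y ∷ ys) len (_ ∷ pos) total = len , s≤s z≤n ∷ pos , cong suc total

∈-compositions⁺ : ∀ n k {xs} → IsComposition n k xs → xs ∈ compositions n k
∈-compositions⁺ zero    zero    {[]}              (refl , [] , refl) = here refl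
∈-compositions⁺ (suc n) (suc k) {suc zero ∷ xs}    (len , _ ∷ pos , total) =
  ∈-++⁺ˡ (∈-map⁺ (1 ∷_) (∈-compositions⁺ n k (suc-injective len , pos , suc-injective total)))
∈-compositions⁺ (suc n) (suc k) {suc (suc x) ∷ xs} (len , _ ∷ pos , total) =
  ∈-++⁺ʳ (map (1 ∷_) (compositions n k))
    (∈-map⁺ incHead (∈-compositions⁺ n (suc k) (len , s≤s z≤n ∷ pos , suc-injective total)))
∈-compositions⁺ zero    (suc k) {_ ∷ _}           (_ , s≤s _ ∷ _ , ())
∈-compositions⁺ (suc n) zero    {[]}              (_ , _ , ())

compositions-unique : ∀ n k → Unique (compositions n k)
compositions-unique zero    zero    = [] ∷ []
compositions-unique zero    (suc k) = []
compositions-unique (suc n) zero    = []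
compositions-unique (suc n) (suc k) =
  Uniqueₚ.++⁺ (Uniqueₚ.map⁺ ∷-injectiveʳ (compositions-unique n k))
             (Uniqueₚ.map⁺ incHead-injective (compositions-unique n (suc k)))
             disjoint
  where
  ∷-injectiveʳ : ∀ {xs ys : List ℕ} → 1 ∷ xs ≡ 1 ∷ ys → xs ≡ ys
  ∷-injectiveʳ refl = refl
  incHead-injective : ∀ {xs ys} → incHead xs ≡ incHead ys → xs ≡ ys
  incHead-injective {[]}    {[]}    _    = refl
  incHead-injective {_ ∷ _} {_ ∷ _} refl = refl
  disjoint : ∀ {xs} → ¬ (xs ∈ map (1 ∷_) (compositions n k) × xs ∈ map incHead (compositions n (suc k)))
  disjoint (xs∈₁ , xs∈₂) with ∈-map⁻ (1 ∷_) xs∈₁ | ∈-map⁻ incHead xs∈₂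
  ... | _ , _ , refl | y ∷ ys , ys∈ , eq with ∈-compositions⁻ n (suc k) ys∈
  ... | _ , s≤s _ ∷ _ , _ with eq
  ... | ()

-- The cycle lemma

Σ₁ Σ₂ : List (ℕ × ℕ) → ℕ
Σ₁ w = sum (map proj₁ w)
Σ₂ w = sum (map proj₂ w)

Balanced : ℕ → List (ℕ × ℕ) → Set
Balanced h w = Σ₂ w ≡ suc (h + Σ₁ w)

Dominated : ℕ → List (ℕ × ℕ) → Set
Dominated h w = ∀ j → j < length w → prefixSum proj₂ j w ≤ h + prefixSum proj₁ j w

offset-≤⇔ : ∀ {x y p q X Y} → x + p ≡ X → y + q ≡ Y → (x ≤ y ⇔ X + q ≤ Y + p)
offset-≤⇔ {x} {y} {p} {q} refl refl = mk⇔
  (λ x≤y → subst₂ _≤_ (sym (+-assoc x p q)) (rearrange y q p) (+-monoˡ-≤ (p + q) x≤y))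
  (λ le → +-cancelʳ-≤ (p + q) x y (subst₂ _≤_ (+-assoc x p q) (sym (rearrange y q p)) le))
  where
  rearrange : ∀ y q p → y + (p + q) ≡ y + q + p
  rearrange y q p = trans (cong (y +_) (+-comm p q)) (sym (+-assoc y q p))

cross-trans : ∀ p q {a₁ b₁ a₂ b₂ a₃ b₃} → p + (b₂ + a₁) ≤ a₂ + b₁ → q + (b₃ + a₂) ≤ a₃ + b₂ →
              (p + q) + (b₃ + a₁) ≤ a₃ + b₁
cross-trans p q {a₁} {b₁} {a₂} {b₂} {a₃} {b₃} le₁ le₂ = +-cancelʳ-≤ (a₂ + b₂) _ _ (begin
  (p + q) + (b₃ + a₁) + (a₂ + b₂)   ≡⟨ regroupˡ p q a₁ a₂ b₂ b₃ ⟩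
  (p + (b₂ + a₁)) + (q + (b₃ + a₂)) ≤⟨ +-mono-≤ le₁ le₂ ⟩
  (a₂ + b₁) + (a₃ + b₂)             ≡⟨ regroupʳ a₂ b₁ a₃ b₂ ⟩
  (a₃ + b₁) + (a₂ + b₂)             ∎)
  where
  open ≤-Reasoning
  regroupˡ : ∀ p q a₁ a₂ b₂ b₃ → (p + q) + (b₃ + a₁) + (a₂ + b₂) ≡ (p + (b₂ + a₁)) + (q + (b₃ + a₂))
  regroupˡ = solve-∀
  regroupʳ : ∀ a₂ b₁ a₃ b₂ → (a₂ + b₁) + (a₃ + b₂) ≡ (a₃ + b₁) + (a₂ + b₂)
  regroupʳ = solve-∀

Balanced⇒nonempty : ∀ {h} w → Balanced h w → 0 < length w
Balanced⇒nonempty (_ ∷ _) _ = s≤s z≤n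

module Excess (z : List (ℕ × ℕ)) where

  private
    L = length z
    a b : ℕ → ℕ
    a t = prefixSum proj₁ t z
    b t = prefixSum proj₂ t z

  -- The excess of index t is b t − a t; t ⟨ p ⟩≼ s says that it is at least p below the excess of s.
  _⟨_⟩≼_ : ℕ → ℕ → ℕ → Set
  t ⟨ p ⟩≼ s = p + (b t + a s) ≤ a t + b s

  _≼_ _≺_ : ℕ → ℕ → Set
  t ≼ s = t ⟨ 0 ⟩≼ s
  t ≺ s = t ⟨ 1 ⟩≼ s

  ≼-refl : ∀ s → s ≼ s
  ≼-refl s = ≤-reflexive (+-comm (b s) (a s))

  ≺⇒≼ : ∀ {t s} → t ≺ s → t ≼ s
  ≺⇒≼ = <⇒≤

  ≼-trans : ∀ {p q u t s} → u ⟨ q ⟩≼ t → t ⟨ p ⟩≼ s → u ⟨ p + q ⟩≼ s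
  ≼-trans {p} {q} {u} {t} {s} u≼t t≼s = cross-trans p q {a s} {b s} {a t} {b t} {a u} {b u} t≼s u≼t

  ≺-≼-trans : ∀ {u t s} → u ≺ t → t ≼ s → u ≺ s
  ≺-≼-trans {u} {t} {s} = ≼-trans {0} {1} {u} {t} {s}

  ≼-≺-trans : ∀ {u t s} → u ≼ t → t ≺ s → u ≺ s
  ≼-≺-trans {u} {t} {s} = ≼-trans {1} {0} {u} {t} {s}

  ≺-irrefl : ∀ s → ¬ s ≺ s
  ≺-irrefl s s≺s = <-irrefl (+-comm (b s) (a s)) s≺s

  IsFirstArgmax : ℕ → ℕ → Set
  IsFirstArgmax n s = s < n × (∀ t → t < n → t ≼ s) × (∀ t → t < s → t ≺ s)

  firstArgmax : ∀ n → ∃ (IsFirstArgmax (suc n))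
  firstArgmax zero = 0 , s≤s z≤n , (λ { 0 _ → ≼-refl 0 ; (suc _) (s≤s ()) }) , (λ _ ())
  firstArgmax (suc n) with firstArgmax n
  ... | s , s<n , below , before with suc (b s + a (suc n)) ≤? a s + b (suc n)
  ...   | yes s≺n = suc n , ≤-refl , below′ , before′
    where
    below′ : ∀ t → t < suc (suc n) → t ≼ suc n
    below′ t t< with m≤n⇒m<n∨m≡n (≤-pred t<)
    ... | inj₂ refl = ≼-refl (suc n)
    ... | inj₁ t<n  = ≺⇒≼ {t} {suc n} (≼-≺-trans {t} {s} {suc n} (below t t<n) s≺n)
    before′ : ∀ t → t < suc n → t ≺ suc n
    before′ t t<n = ≼-≺-trans {t} {s} {suc n} (below t t<n) s≺n
  ...   | no  s⊀n = s , m<n⇒m<1+n s<n , below′ , before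
    where
    below′ : ∀ t → t < suc (suc n) → t ≼ s
    below′ t t< with m≤n⇒m<n∨m≡n (≤-pred t<)
    ... | inj₂ refl = subst₂ _≤_ (+-comm (a s) (b (suc n))) (+-comm (b s) (a (suc n))) (≮⇒≥ s⊀n)
    ... | inj₁ t<n  = below t t<n

  firstArgmax-unique : ∀ {n s s′} → IsFirstArgmax n s → IsFirstArgmax n s′ → s ≡ s′
  firstArgmax-unique {s = s} {s′} (s<n , below , before) (s′<n , below′ , before′) with <-cmp s s′
  ... | tri< s<s′ _ _ = ⊥-elim (≺-irrefl s (≺-≼-trans {s} {s′} {s} (before′ s s<s′) (below s′ s′<n)))
  ... | tri≈ _ s≡s′ _ = s≡s′
  ... | tri> _ _ s′<s = ⊥-elim (≺-irrefl s′ (≺-≼-trans {s′} {s} {s′} (before s′ s′<s) (below′ s s<n)))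

  private
    a′ b′ : ℕ → ℕ → ℕ
    a′ s j = prefixSum proj₁ j (rotate s z)
    b′ s j = prefixSum proj₂ j (rotate s z)

  unwrapped-prefix⇔ : ∀ s j → j ≤ L ∸ s → (b′ s j ≤ a′ s j ⇔ (s + j) ≼ s)
  unwrapped-prefix⇔ s j j≤ = offset-≤⇔ (prefixSum-rotate proj₂ z s j j≤) (prefixSum-rotate proj₁ z s j j≤)

  module _ (balance : Balanced 0 z) where

    -- A wrapped prefix contains all of z, whose excess is 1; hence the strict comparison.
    wrapped-prefix⇔ : ∀ s t → t ≤ s → (b′ s (L ∸ s + t) ≤ a′ s (L ∸ s + t) ⇔ t ≺ s)
    wrapped-prefix⇔ s t t≤s = mk⇔
      (λ le → +-cancelˡ-≤ (Σ₁ z) _ _ (subst₂ _≤_ (shift-suc (b t) (a s)) (+-assoc (Σ₁ z) (a t) (b s))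
                                        (to (offset-≤⇔ wrapped₂ wrapped₁) le)))
      (λ t≺s → from (offset-≤⇔ wrapped₂ wrapped₁)
                 (subst₂ _≤_ (sym (shift-suc (b t) (a s))) (sym (+-assoc (Σ₁ z) (a t) (b s)))
                   (+-monoʳ-≤ (Σ₁ z) t≺s)))
      where
      wrapped₁ = prefixSum-rotate-wrap proj₁ z s t t≤s
      wrapped₂ = prefixSum-rotate-wrap proj₂ z s t t≤s
      shift-suc : ∀ x y → Σ₂ z + x + y ≡ Σ₁ z + suc (x + y)
      shift-suc x y = trans (cong (λ σ → σ + x + y) balance)
                            (trans (+-assoc (suc (Σ₁ z)) x y) (sym (+-suc (Σ₁ z) (x + y))))

    dominated⇔firstArgmax : ∀ s → s < L → (Dominated 0 (rotate s z) ⇔ IsFirstArgmax L s)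
    dominated⇔firstArgmax s s<L = mk⇔ firstArgmax-of dominated-by
      where
      |rotation| : length (rotate s z) ≡ L
      |rotation| = length-rotate s z (<⇒≤ s<L)
      s+[L∸s]≡L : s + (L ∸ s) ≡ L
      s+[L∸s]≡L = m+[n∸m]≡n (<⇒≤ s<L)
      wrapped-index< : ∀ t → t < s → L ∸ s + t < length (rotate s z)
      wrapped-index< t t<s = subst (L ∸ s + t <_) (sym (trans |rotation| (sym (trans (+-comm (L ∸ s) s) s+[L∸s]≡L))))
                                   (+-monoʳ-< (L ∸ s) t<s)

      firstArgmax-of : Dominated 0 (rotate s z) → IsFirstArgmax L s
      firstArgmax-of dom = s<L , below , before
        where
        before : ∀ t → t < s → t ≺ s
        before t t<s = to (wrapped-prefix⇔ s t (<⇒≤ t<s)) (dom _ (wrapped-index< t t<s))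
        below : ∀ t → t < L → t ≼ s
        below t t<L with s ≤? t
        ... | no  s≰t = ≺⇒≼ {t} {s} (before t (≰⇒> s≰t))
        ... | yes s≤t = subst (_≼ s) (m+[n∸m]≡n s≤t)
                          (to (unwrapped-prefix⇔ s (t ∸ s) (∸-monoˡ-≤ s (<⇒≤ t<L)))
                              (dom (t ∸ s) (subst (t ∸ s <_) (sym |rotation|) (≤-<-trans (m∸n≤m t s) t<L))))

      dominated-by : IsFirstArgmax L s → Dominated 0 (rotate s z)
      dominated-by (_ , below , before) j j< with L ∸ s ≤? j
      ... | no  j≱ = from (unwrapped-prefix⇔ s j (<⇒≤ (≰⇒> j≱)))
                          (below (s + j) (subst (s + j <_) s+[L∸s]≡L (+-monoʳ-< s (≰⇒> j≱))))
      ... | yes j≥ = subst (λ i → b′ s i ≤ a′ s i) (m+[n∸m]≡n j≥)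
                       (from (wrapped-prefix⇔ s t (<⇒≤ t<s)) (before t t<s))
        where
        t = j ∸ (L ∸ s)
        t<s : t < s
        t<s = +-cancelˡ-< (L ∸ s) t s
                (subst₂ _<_ (sym (m+[n∸m]≡n j≥)) (trans (sym s+[L∸s]≡L) (+-comm s (L ∸ s)))
                  (subst (j <_) |rotation| j<))

cycleShift : List (ℕ × ℕ) → ℕ
cycleShift []       = 0
cycleShift (x ∷ xs) = proj₁ (Excess.firstArgmax (x ∷ xs) (length xs))

cycleShift-firstArgmax : ∀ z → 0 < length z → Excess.IsFirstArgmax z (length z) (cycleShift z)
cycleShift-firstArgmax (x ∷ xs) _ = proj₂ (Excess.firstArgmax (x ∷ xs) (length xs))

module _ (z : List (ℕ × ℕ)) (balance : Balanced 0 z) where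
  open Excess z

  cycleShift-dominated : cycleShift z < length z × Dominated 0 (rotate (cycleShift z) z)
  cycleShift-dominated = s<L , from (dominated⇔firstArgmax balance (cycleShift z) s<L) first
    where
    first = cycleShift-firstArgmax z (Balanced⇒nonempty z balance)
    s<L = proj₁ first

  dominated⇒≡cycleShift : ∀ {s} → s < length z → Dominated 0 (rotate s z) → s ≡ cycleShift z
  dominated⇒≡cycleShift {s} s<L dom = firstArgmax-unique (to (dominated⇔firstArgmax balance s s<L) dom)
                                        (cycleShift-firstArgmax z (Balanced⇒nonempty z balance))

-- Good sequences and depth codes

-- Good h ((ℓ₁ , e₁) ∷ …): h is the depth of the vertex where the first extended leaf stops, and eᵢ is the
-- number of edges from the i-th leaf up to the vertex where the next extended leaf stops (for the last
-- leaf: up to one above the root).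
data Good : ℕ → List (ℕ × ℕ) → Set where
  last : ∀ {h l e}   → 1 ≤ l → e ≡ suc (h + l) → Good h ((l , e) ∷ [])
  step : ∀ {h l e w} → 1 ≤ l → 1 ≤ e → e ≤ h + l → Good (h + l ∸ e) w → Good h ((l , e) ∷ w)

Good-balance : ∀ {h w} → Good h w → Balanced h w
Good-balance {h} (last {l = l} {e} _ e≡) =
  trans (+-identityʳ e) (trans e≡ (cong (λ x → suc (h + x)) (sym (+-identityʳ l))))
Good-balance {h} (step {l = l} {e} {w} _ _ e≤ good) = begin
  e + Σ₂ w                         ≡⟨ cong (e +_) (Good-balance good) ⟩
  e + suc (h + l ∸ e + Σ₁ w)       ≡⟨ shuffle e (h + l ∸ e) (Σ₁ w) ⟩
  suc ((h + l ∸ e + e) + Σ₁ w)     ≡⟨ cong (λ x → suc (x + Σ₁ w)) (m∸n+n≡m e≤) ⟩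
  suc (h + l + Σ₁ w)               ≡⟨ cong suc (+-assoc h l (Σ₁ w)) ⟩
  suc (h + (l + Σ₁ w))             ∎
  where
  open ≡-Reasoning
  shuffle : ∀ a b c → a + suc (b + c) ≡ suc ((b + a) + c)
  shuffle = solve-∀

Good-positive : ∀ {h w} → Good h w → Positive (map proj₂ w)
Good-positive (last _ refl)        = s≤s z≤n ∷ []
Good-positive (step _ e≥1 _ good)  = e≥1 ∷ Good-positive good

private
  regroup : ∀ h l e X → e ≤ h + l → h + (l + X) ≡ e + ((h + l ∸ e) + X)
  regroup h l e X e≤ = begin
    h + (l + X)           ≡⟨ sym (+-assoc h l X) ⟩
    (h + l) + X           ≡⟨ cong (_+ X) (sym (m∸n+n≡m e≤)) ⟩
    ((h + l ∸ e) + e) + X ≡⟨ cong (_+ X) (+-comm (h + l ∸ e) e) ⟩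
    (e + (h + l ∸ e)) + X ≡⟨ +-assoc e (h + l ∸ e) X ⟩
    e + ((h + l ∸ e) + X) ∎
    where open ≡-Reasoning

Good⇒Dominated : ∀ {h w} → Good h w → Dominated h w
Good⇒Dominated good zero _ = z≤n
Good⇒Dominated (last _ _) (suc j) (s≤s ())
Good⇒Dominated {h} (step {l = l} {e} {w} _ _ e≤ good) (suc j) (s≤s j<) =
  ≤-trans (+-monoʳ-≤ e (Good⇒Dominated good j j<)) (≤-reflexive (sym (regroup h l e (prefixSum proj₁ j w) e≤)))

Dominated⇒Good : ∀ {h} w → Positive (map proj₁ w) → Positive (map proj₂ w) →
                 Balanced h w → Dominated h w → Good h w
Dominated⇒Good {h} ((l , e) ∷ []) (l≥1 ∷ _) (e≥1 ∷ _) balance _ =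
  last l≥1 (trans (sym (+-identityʳ e)) (trans balance (cong (λ x → suc (h + x)) (+-identityʳ l))))
Dominated⇒Good {h} ((l , e) ∷ w@(_ ∷ _)) (l≥1 ∷ pos₁) (e≥1 ∷ pos₂) balance dom =
  step l≥1 e≥1 e≤ (Dominated⇒Good w pos₁ pos₂ balance′ dom′)
  where
  e≤ : e ≤ h + l
  e≤ = subst₂ _≤_ (+-identityʳ e) (cong (h +_) (+-identityʳ l)) (dom 1 (s≤s (s≤s z≤n)))
  dom′ : Dominated (h + l ∸ e) w
  dom′ j j< = +-cancelˡ-≤ e _ _ (≤-trans (dom (suc j) (s≤s j<)) (≤-reflexive (regroup h l e _ e≤)))
  balance′ : Balanced (h + l ∸ e) w
  balance′ = +-cancelˡ-≡ e _ _ (trans balance (trans (cong suc (regroup h l e (Σ₁ w) e≤)) (sym (+-suc e _))))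

rotate-Dominated⇒Good : ∀ {h} s w → Positive (map proj₁ w) → Positive (map proj₂ w) → Balanced h w →
                        Dominated h (rotate s w) → Good h (rotate s w)
rotate-Dominated⇒Good {h} s w pos₁ pos₂ balance =
  Dominated⇒Good (rotate s w) (rotated pos₁) (rotated pos₂) balance′
  where
  rotated : ∀ {f : ℕ × ℕ → ℕ} → Positive (map f w) → Positive (map f (rotate s w))
  rotated {f} pos = subst Positive (sym (map-rotate f s w)) (All-rotate s pos)
  balance′ : Balanced h (rotate s w)
  balance′ = trans (sum-map-rotate proj₂ s w)
                   (trans balance (cong (λ σ → suc (h + σ)) (sym (sum-map-rotate proj₁ s w))))

-- In a depth code an entry (l , h) is a leaf at depth h + l whose extended leaf stops at depth h;
-- ValidTail l h xs says that each later extended leaf stops strictly above the leaf before it.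
data ValidTail : ℕ → ℕ → List (ℕ × ℕ) → Set where
  []   : ∀ {l h} → ValidTail l h []
  _∷_  : ∀ {l h l′ h′ xs} → (1 ≤ l′ × h′ < h + l) → ValidTail l′ h′ xs → ValidTail l h ((l′ , h′) ∷ xs)

data ValidCode : List (ℕ × ℕ) → Set where
  []    : ValidCode []
  start : ∀ {l xs} → 1 ≤ l → ValidTail l 0 xs → ValidCode ((l , 0) ∷ xs)

heights : ℕ → List (ℕ × ℕ) → List (ℕ × ℕ)
heights h []             = []
heights h ((l , e) ∷ w)  = (l , h) ∷ heights (h + l ∸ e) w

descents : List (ℕ × ℕ) → List (ℕ × ℕ)
descents []                          = []
descents ((l , h) ∷ [])              = (l , suc (h + l)) ∷ []
descents ((l , h) ∷ (l′ , h′) ∷ w)   = (l , h + l ∸ h′) ∷ descents ((l′ , h′) ∷ w)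

map-proj₁-heights : ∀ h w → map proj₁ (heights h w) ≡ map proj₁ w
map-proj₁-heights h []            = refl
map-proj₁-heights h ((l , e) ∷ w) = cong (l ∷_) (map-proj₁-heights _ w)

map-proj₁-descents : ∀ w → map proj₁ (descents w) ≡ map proj₁ w
map-proj₁-descents []                        = refl
map-proj₁-descents ((l , h) ∷ [])            = refl
map-proj₁-descents ((l , h) ∷ (l′ , h′) ∷ w) = cong (l ∷_) (map-proj₁-descents ((l′ , h′) ∷ w))

Good⇒ValidTail : ∀ {h l e w} → Good h ((l , e) ∷ w) → ValidTail l h (heights (h + l ∸ e) w)
Good⇒ValidTail (last _ _) = []
Good⇒ValidTail {h} {l} {e} (step _ e≥1 e≤ good@(last l′≥1 _))     =
  (l′≥1 , ∸-monoʳ-< e≥1 e≤) ∷ Good⇒ValidTail good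
Good⇒ValidTail {h} {l} {e} (step _ e≥1 e≤ good@(step l′≥1 _ _ _)) =
  (l′≥1 , ∸-monoʳ-< e≥1 e≤) ∷ Good⇒ValidTail good

Good⇒ValidCode : ∀ {w} → Good 0 w → ValidCode (heights 0 w)
Good⇒ValidCode good@(last l≥1 _)     = start l≥1 (Good⇒ValidTail good)
Good⇒ValidCode good@(step l≥1 _ _ _) = start l≥1 (Good⇒ValidTail good)

descents-heights : ∀ {h w} → Good h w → descents (heights h w) ≡ w
descents-heights (last _ e≡) = cong (λ e → (_ , e) ∷ []) (sym e≡)
descents-heights (step {l = l} _ _ e≤ good@(last _ _))     =
  cong₂ (λ e w → (l , e) ∷ w) (m∸[m∸n]≡n e≤) (descents-heights good)
descents-heights (step {l = l} _ _ e≤ good@(step _ _ _ _)) =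
  cong₂ (λ e w → (l , e) ∷ w) (m∸[m∸n]≡n e≤) (descents-heights good)

heights-descents : ∀ {l h xs} → ValidTail l h xs → heights h (descents ((l , h) ∷ xs)) ≡ (l , h) ∷ xs
heights-descents []                                    = refl
heights-descents {l} {h} (_∷_ {l′ = l′} {h′} {xs} (_ , h′<) valid) =
  cong ((l , h) ∷_) (trans (cong (λ x → heights x (descents ((l′ , h′) ∷ xs))) (m∸[m∸n]≡n (<⇒≤ h′<)))
                           (heights-descents valid))

ValidTail⇒Good : ∀ {l h xs} → 1 ≤ l → ValidTail l h xs → Good h (descents ((l , h) ∷ xs))
ValidTail⇒Good l≥1 [] = last l≥1 refl
ValidTail⇒Good {l} {h} l≥1 (_∷_ {l′ = l′} {h′} {xs} (l′≥1 , h′<) valid) =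
  step l≥1 (m<n⇒0<n∸m h′<) (m∸n≤m (h + l) h′)
    (subst (λ x → Good x (descents ((l′ , h′) ∷ xs))) (sym (m∸[m∸n]≡n (<⇒≤ h′<))) (ValidTail⇒Good l′≥1 valid))

-- Depth codes of plane trees

deepen : ℕ × ℕ → ℕ × ℕ
deepen (l , h) = l , suc h

attach : List (ℕ × ℕ) → List (ℕ × ℕ)
attach []             = []
attach ((l , h) ∷ xs) = (suc l , h) ∷ map deepen xs

-- The depth code of t: for each leaf, its entry of ext t and the depth below the root of t of the vertex
-- where its extended leaf stops (0 for the leftmost leaf, whose walk is still open).
mutual
  leafCode : PTree → List (ℕ × ℕ)
  leafCode (node [])       = (0 , 0) ∷ []
  leafCode (node (c ∷ cs)) = leafCodes (c ∷ cs)

  leafCodes : List PTree → List (ℕ × ℕ)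
  leafCodes []       = []
  leafCodes (c ∷ cs) = attach (leafCode c) ++ leafCodes cs

map-proj₁-deepen : ∀ xs → map proj₁ (map deepen xs) ≡ map proj₁ xs
map-proj₁-deepen []       = refl
map-proj₁-deepen (x ∷ xs) = cong (proj₁ x ∷_) (map-proj₁-deepen xs)

map-proj₁-attach : ∀ xs → map proj₁ (attach xs) ≡ incHead (map proj₁ xs)
map-proj₁-attach []             = refl
map-proj₁-attach ((l , h) ∷ xs) = cong (suc l ∷_) (map-proj₁-deepen xs)

mutual
  map-proj₁-leafCode : ∀ t → map proj₁ (leafCode t) ≡ ext t
  map-proj₁-leafCode (node [])       = refl
  map-proj₁-leafCode (node (c ∷ cs)) = map-proj₁-leafCodes (c ∷ cs)

  map-proj₁-leafCodes : ∀ cs → map proj₁ (leafCodes cs) ≡ extL cs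
  map-proj₁-leafCodes []       = refl
  map-proj₁-leafCodes (c ∷ cs) = begin
    map proj₁ (attach (leafCode c) ++ leafCodes cs)
      ≡⟨ map-++ proj₁ (attach (leafCode c)) (leafCodes cs) ⟩
    map proj₁ (attach (leafCode c)) ++ map proj₁ (leafCodes cs)
      ≡⟨ cong₂ _++_ (trans (map-proj₁-attach (leafCode c)) (cong incHead (map-proj₁-leafCode c)))
                    (map-proj₁-leafCodes cs) ⟩
    incHead (ext c) ++ extL cs ∎
    where open ≡-Reasoning

length-incHead : ∀ xs → length (incHead xs) ≡ length xs
length-incHead []       = refl
length-incHead (x ∷ xs) = refl

mutual
  length-ext : ∀ t → length (ext t) ≡ leavesSub t
  length-ext (node [])       = refl
  length-ext (node (c ∷ cs)) = length-extL (c ∷ cs)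

  length-extL : ∀ cs → length (extL cs) ≡ leavesL cs
  length-extL []       = refl
  length-extL (c ∷ cs) = trans (length-++ (incHead (ext c)))
    (cong₂ _+_ (trans (length-incHead (ext c)) (length-ext c)) (length-extL cs))

ValidTail-deepen : ∀ {l h xs} → ValidTail l h xs → ValidTail l (suc h) (map deepen xs)
ValidTail-deepen []                = []
ValidTail-deepen ((l≥1 , h<) ∷ v) = (l≥1 , s≤s h<) ∷ ValidTail-deepen v

ValidTail-attach : ∀ {l h xs} → ValidTail l h xs → ValidTail (suc l) h (map deepen xs)
ValidTail-attach []                = []
ValidTail-attach {l} {h} (_∷_ {h′ = h′} (l≥1 , h′<) v) =
  (l≥1 , subst (suc (suc h′) ≤_) (sym (+-suc h l)) (s≤s h′<)) ∷ ValidTail-deepen v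

ValidTail-++ : ∀ {l h xs l′ ys} → 1 ≤ l → ValidTail l h xs → 1 ≤ l′ → ValidTail l′ 0 ys →
               ValidTail l h (xs ++ (l′ , 0) ∷ ys)
ValidTail-++ {l} {h} l≥1 []           l′≥1 v′ = (l′≥1 , ≤-trans l≥1 (m≤n+m l h)) ∷ v′
ValidTail-++         _   ((l≥1 , h<) ∷ v) l′≥1 v′ = (l≥1 , h<) ∷ ValidTail-++ l≥1 v l′≥1 v′

record Rooted (w : List (ℕ × ℕ)) : Set where
  constructor rooted
  field
    {first} : ℕ
    {rest}  : List (ℕ × ℕ)
    code≡   : w ≡ (first , 0) ∷ rest
    valid   : ValidTail first 0 rest

mutual
  leafCode-rooted : ∀ t → Rooted (leafCode t)
  leafCode-rooted (node [])       = rooted refl []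
  leafCode-rooted (node (c ∷ cs)) = proj₁ (leafCodes-rooted c cs)

  leafCodes-rooted : ∀ c cs → Σ (Rooted (leafCodes (c ∷ cs))) λ r → 1 ≤ Rooted.first r
  leafCodes-rooted c cs with leafCode-rooted c
  ... | rooted {l} {xs} eq v rewrite eq = rooted refl (valid-rest cs) , s≤s z≤n
    where
    valid-rest : ∀ cs → ValidTail (suc l) 0 (map deepen xs ++ leafCodes cs)
    valid-rest []       rewrite ++-identityʳ (map deepen xs) = ValidTail-attach v
    valid-rest (d ∷ ds) with leafCodes-rooted d ds
    ... | rooted eq v′ , l′≥1 rewrite eq = ValidTail-++ (s≤s z≤n) (ValidTail-attach v) l′≥1 v′

leafCodes-valid : ∀ cs → ValidCode (leafCodes cs)
leafCodes-valid []       = []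
leafCodes-valid (c ∷ cs) with leafCodes-rooted c cs
... | rooted eq v , l≥1 rewrite eq = start l≥1 v

data AtRoot : List (ℕ × ℕ) → Set where
  []  : AtRoot []
  _∷_ : ∀ l xs → AtRoot ((l , 0) ∷ xs)

ValidCode⇒AtRoot : ∀ {w} → ValidCode w → AtRoot w
ValidCode⇒AtRoot []          = []
ValidCode⇒AtRoot (start _ _) = _ ∷ _

-- Splits off the entries of the first child: those below the root, up to the next entry at the root.
splitChild : List (ℕ × ℕ) → List (ℕ × ℕ) × List (ℕ × ℕ)
splitChild []                 = [] , []
splitChild ((l , zero) ∷ xs)  = [] , (l , zero) ∷ xs
splitChild ((l , suc h) ∷ xs) = (l , h) ∷ proj₁ (splitChild xs) , proj₂ (splitChild xs)

splitChild-deepen-++ : ∀ xs ys → AtRoot ys → splitChild (map deepen xs ++ ys) ≡ (xs , ys)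
splitChild-deepen-++ []             []       []      = refl
splitChild-deepen-++ []             (_ ∷ ys) (_ ∷ _) = refl
splitChild-deepen-++ ((l , h) ∷ xs) ys       ys₀ rewrite splitChild-deepen-++ xs ys ys₀ = refl

splitChild-correct : ∀ xs → xs ≡ map deepen (proj₁ (splitChild xs)) ++ proj₂ (splitChild xs)
splitChild-correct []                 = refl
splitChild-correct ((l , zero) ∷ xs)  = refl
splitChild-correct ((l , suc h) ∷ xs) = cong ((l , suc h) ∷_) (splitChild-correct xs)

splitChild-AtRoot : ∀ xs → AtRoot (proj₂ (splitChild xs))
splitChild-AtRoot []                 = []
splitChild-AtRoot ((l , zero) ∷ xs)  = l ∷ xs
splitChild-AtRoot ((l , suc h) ∷ xs) = splitChild-AtRoot xs

-- The fuel N only has to bound Σ₁ of the code; decodeTree N l xs rebuilds the tree c with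
-- attach (leafCode c) ≡ (l , 0) ∷ map deepen xs.
mutual
  decodeForest : ℕ → List (ℕ × ℕ) → List PTree
  decodeForest zero    _              = []
  decodeForest (suc N) []             = []
  decodeForest (suc N) ((l , _) ∷ xs) =
    decodeTree N l (proj₁ (splitChild xs)) ∷ decodeForest N (proj₂ (splitChild xs))

  decodeTree : ℕ → ℕ → List (ℕ × ℕ) → PTree
  decodeTree N zero          xs = node []
  decodeTree N (suc zero)    xs = node []
  decodeTree N (suc (suc l)) xs = node (decodeForest N ((suc l , 0) ∷ xs))

decodeForest-[] : ∀ N → decodeForest N [] ≡ []
decodeForest-[] zero    = refl
decodeForest-[] (suc N) = refl

Σ₁-deepen-++ : ∀ xs ys → Σ₁ (map deepen xs ++ ys) ≡ Σ₁ xs + Σ₁ ys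
Σ₁-deepen-++ xs ys = trans (sum-map-++ proj₁ (map deepen xs) ys) (cong (_+ Σ₁ ys) (cong sum (map-proj₁-deepen xs)))

private
  split-bound : ∀ l x y {N} → l + (x + y) ≤ N → l + x ≤ N × y ≤ N
  split-bound l x y bound = ≤-trans (m≤m+n (l + x) y) bound′ , ≤-trans (m≤n+m y (l + x)) bound′
    where bound′ = ≤-trans (≤-reflexive (+-assoc l x y)) bound

mutual
  decodeForest-leafCodes : ∀ N cs → Σ₁ (leafCodes cs) ≤ N → decodeForest N (leafCodes cs) ≡ cs
  decodeForest-leafCodes N [] _ = decodeForest-[] N
  decodeForest-leafCodes zero (c ∷ cs) bound with leafCodes-rooted c cs
  ... | rooted eq _ , l≥1 rewrite eq with ≤-trans l≥1 (≤-trans (m≤m+n _ _) bound)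
  ... | ()
  decodeForest-leafCodes (suc N) (c ∷ cs) bound with leafCode-rooted c
  ... | rooted {l} {xs} eq _
    rewrite eq | splitChild-deepen-++ xs (leafCodes cs) (ValidCode⇒AtRoot (leafCodes-valid cs)) =
    cong₂ _∷_ (decodeTree-leafCode N c eq (proj₁ bounds)) (decodeForest-leafCodes N cs (proj₂ bounds))
    where
    bounds = split-bound l (Σ₁ xs) (Σ₁ (leafCodes cs))
               (≤-pred (subst (λ σ → suc l + σ ≤ suc N) (Σ₁-deepen-++ xs (leafCodes cs)) bound))

  decodeTree-leafCode : ∀ N c {l xs} → leafCode c ≡ (l , 0) ∷ xs → l + Σ₁ xs ≤ N → decodeTree N (suc l) xs ≡ c
  decodeTree-leafCode N (node [])       refl _ = refl
  decodeTree-leafCode N (node (d ∷ ds)) {zero} eq _ with leafCodes-rooted d ds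
  ... | rooted eq′ _ , l≥1 with trans (sym eq) eq′
  ... | refl with l≥1
  ... | ()
  decodeTree-leafCode N (node (d ∷ ds)) {suc l} {xs} eq bound =
    cong node (trans (cong (decodeForest N) (sym eq))
                     (decodeForest-leafCodes N (d ∷ ds) (subst (_≤ N) (cong Σ₁ (sym eq)) bound)))

ValidTail-suffix : ∀ {l h l′ h′ ys} xs → ValidTail l h (xs ++ (l′ , h′) ∷ ys) → 1 ≤ l′ × ValidTail l′ h′ ys
ValidTail-suffix []       ((l′≥1 , _) ∷ v) = l′≥1 , v
ValidTail-suffix (x ∷ xs) (_ ∷ v)          = ValidTail-suffix xs v

ValidCode-suffix : ∀ {l h} xs ys → AtRoot ys → ValidTail l h (map deepen xs ++ ys) → ValidCode ys
ValidCode-suffix xs [] [] _ = []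
ValidCode-suffix xs ((l′ , 0) ∷ ys) (_ ∷ _) v with ValidTail-suffix (map deepen xs) v
... | l′≥1 , v′ = start l′≥1 v′

ValidTail-undeepen : ∀ {l h} xs ys → ValidTail l (suc h) (map deepen xs ++ ys) → ValidTail l h xs
ValidTail-undeepen []             ys _                  = []
ValidTail-undeepen ((l′ , h′) ∷ xs) ys ((l′≥1 , h<) ∷ v) = (l′≥1 , ≤-pred h<) ∷ ValidTail-undeepen xs ys v

ValidTail-detach : ∀ {l} xs ys → ValidTail (suc (suc l)) 0 (map deepen xs ++ ys) → ValidTail (suc l) 0 xs
ValidTail-detach []               ys _                  = []
ValidTail-detach ((l′ , h′) ∷ xs) ys ((l′≥1 , h<) ∷ v) = (l′≥1 , ≤-pred h<) ∷ ValidTail-undeepen xs ys v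

ValidTail-leaf : ∀ xs ys → ValidTail 1 0 (map deepen xs ++ ys) → xs ≡ []
ValidTail-leaf []               ys _                   = refl
ValidTail-leaf ((l′ , h′) ∷ xs) ys ((_ , s≤s ()) ∷ _)

leafCode-node : ∀ cs {x xs} → leafCodes cs ≡ x ∷ xs → leafCode (node cs) ≡ x ∷ xs
leafCode-node (c ∷ cs) eq = eq

mutual
  leafCodes-decodeForest : ∀ N w → ValidCode w → Σ₁ w ≤ N → leafCodes (decodeForest N w) ≡ w
  leafCodes-decodeForest N       []               []              _     = cong leafCodes (decodeForest-[] N)
  leafCodes-decodeForest zero    ((suc l , 0) ∷ xs) (start _ _)  ()
  leafCodes-decodeForest (suc N) ((l , 0) ∷ xs)     (start l≥1 v) bound =
    begin
      attach (leafCode (decodeTree N l a)) ++ leafCodes (decodeForest N b)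
        ≡⟨ cong₂ _++_ (attach-leafCode-decodeTree N l≥1 a b v′ (proj₁ bounds))
                      (leafCodes-decodeForest N b (ValidCode-suffix a b (splitChild-AtRoot xs) v′) (proj₂ bounds)) ⟩
      (l , 0) ∷ map deepen a ++ b
        ≡⟨ cong ((l , 0) ∷_) (sym xs≡) ⟩
      (l , 0) ∷ xs ∎
    where
    open ≡-Reasoning
    a = proj₁ (splitChild xs)
    b = proj₂ (splitChild xs)
    xs≡ : xs ≡ map deepen a ++ b
    xs≡ = splitChild-correct xs
    v′ : ValidTail l 0 (map deepen a ++ b)
    v′ = subst (ValidTail l 0) xs≡ v
    bound′ : l + (Σ₁ a + Σ₁ b) ≤ suc N
    bound′ = subst (λ σ → l + σ ≤ suc N) (trans (cong Σ₁ xs≡) (Σ₁-deepen-++ a b)) bound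
    bounds : l + Σ₁ a ≤ suc N × Σ₁ b ≤ N
    bounds = proj₁ (split-bound l (Σ₁ a) (Σ₁ b) bound′)
           , ≤-pred (≤-trans (+-monoˡ-≤ (Σ₁ b) l≥1) (≤-trans (+-monoʳ-≤ l (m≤n+m (Σ₁ b) (Σ₁ a))) bound′))

  attach-leafCode-decodeTree : ∀ N {l} → 1 ≤ l → ∀ a b → ValidTail l 0 (map deepen a ++ b) → l + Σ₁ a ≤ suc N →
                               attach (leafCode (decodeTree N l a)) ≡ (l , 0) ∷ map deepen a
  attach-leafCode-decodeTree N {suc zero} _ a b v _ rewrite ValidTail-leaf a b v = refl
  attach-leafCode-decodeTree N {suc (suc l)} _ a b v bound =
    cong attach (leafCode-node (decodeForest N ((suc l , 0) ∷ a))
                  (leafCodes-decodeForest N ((suc l , 0) ∷ a) (start (s≤s z≤n) (ValidTail-detach a b v))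
                                          (≤-pred bound)))

encode : List PTree → List (ℕ × ℕ)
encode cs = descents (leafCodes cs)

decode : List (ℕ × ℕ) → List PTree
decode w = decodeForest (Σ₁ w) (heights 0 w)

map-proj₁-encode : ∀ cs → map proj₁ (encode cs) ≡ extL cs
map-proj₁-encode cs = trans (map-proj₁-descents (leafCodes cs)) (map-proj₁-leafCodes cs)

encode-Good : ∀ c cs → Good 0 (encode (c ∷ cs))
encode-Good c cs with leafCodes-rooted c cs
... | rooted eq v , l≥1 rewrite eq = ValidTail⇒Good l≥1 v

decode-encode : ∀ cs → decode (encode cs) ≡ cs
decode-encode []       = refl
decode-encode (c ∷ cs) with leafCodes-rooted c cs
... | rooted eq v , _ = begin
  decodeForest (Σ₁ (encode (c ∷ cs))) (heights 0 (descents (leafCodes (c ∷ cs))))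
    ≡⟨ cong₂ decodeForest (cong sum (map-proj₁-descents (leafCodes (c ∷ cs))))
                          (trans (cong (λ w → heights 0 (descents w)) eq) (trans (heights-descents v) (sym eq))) ⟩
  decodeForest (Σ₁ (leafCodes (c ∷ cs))) (leafCodes (c ∷ cs))
    ≡⟨ decodeForest-leafCodes _ (c ∷ cs) ≤-refl ⟩
  c ∷ cs ∎
  where open ≡-Reasoning

encode-decode : ∀ {w} → Good 0 w → encode (decode w) ≡ w
encode-decode {w} good = begin
  descents (leafCodes (decodeForest (Σ₁ w) (heights 0 w)))
    ≡⟨ cong descents (leafCodes-decodeForest (Σ₁ w) (heights 0 w) (Good⇒ValidCode good)
                        (≤-reflexive (cong sum (map-proj₁-heights 0 w)))) ⟩
  descents (heights 0 w)
    ≡⟨ descents-heights good ⟩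
  w ∎
  where open ≡-Reasoning

module Counting (k : ℕ) (μ : List ℕ) (|μ| : length μ ≡ k) (μ-positive : Positive μ) (Σμ : sum μ ≡ 2 * k + 1) where

  weights : List (List ℕ)
  weights = compositions (suc (2 * k + 1)) k

  shift : List ℕ → ℕ
  shift e = cycleShift (zip μ e)

  code : List ℕ → List (ℕ × ℕ)
  code e = rotate (shift e) (zip μ e)

  tree : List ℕ → PTree
  tree e = node (decode (code e))

  module Weight {e} (e∈ : e ∈ weights) where
    composition : IsComposition (suc (2 * k + 1)) k e
    composition = ∈-compositions⁻ _ k e∈

    |μ|≡|e| : length μ ≡ length e
    |μ|≡|e| = trans |μ| (sym (proj₁ composition))

    first : map proj₁ (zip μ e) ≡ μ
    first = map-proj₁-zip μ e |μ|≡|e|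

    second : map proj₂ (zip μ e) ≡ e
    second = map-proj₂-zip μ e |μ|≡|e|

    balanced : Balanced 0 (zip μ e)
    balanced = trans (cong sum second)
                     (trans (proj₂ (proj₂ composition)) (cong suc (sym (trans (cong sum first) Σμ))))

    |zip| : length (zip μ e) ≡ k
    |zip| = trans (sym (length-map proj₁ (zip μ e))) (trans (cong length first) |μ|)

    shift<k : shift e < k
    shift<k = subst (shift e <_) |zip| (proj₁ (cycleShift-dominated (zip μ e) balanced))

    good : Good 0 (code e)
    good = rotate-Dominated⇒Good (shift e) (zip μ e)
             (subst Positive (sym first) μ-positive) (subst Positive (sym second) (proj₁ (proj₂ composition)))
             balanced (proj₂ (cycleShift-dominated (zip μ e) balanced))

    map-proj₁-code : map proj₁ (code e) ≡ rotate (shift e) μ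
    map-proj₁-code = trans (map-rotate proj₁ (shift e) (zip μ e)) (cong (rotate (shift e)) first)

    extLeafLengths-tree : extLeafLengths (tree e) ≡ rotate (shift e) μ
    extLeafLengths-tree = begin
      extL (decode (code e))               ≡⟨ sym (map-proj₁-encode (decode (code e))) ⟩
      map proj₁ (encode (decode (code e))) ≡⟨ cong (map proj₁) (encode-decode good) ⟩
      map proj₁ (code e)                   ≡⟨ map-proj₁-code ⟩
      rotate (shift e) μ                   ∎
      where open ≡-Reasoning

    shift<|μ| : shift e < length μ
    shift<|μ| = subst (shift e <_) (sym |μ|) shift<k

    zip-from-code : zip μ e ≡ rotate (k ∸ shift e) (code e)
    zip-from-code = sym (subst (λ n → rotate (n ∸ shift e) (code e) ≡ zip μ e) |zip|
                          (rotate-∸-rotate (shift e) (zip μ e) (<⇒≤ (subst (shift e <_) (sym |zip|) shift<k))))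

  tree-shape : ∀ {e} → e ∈ weights → leaves (tree e) ≡ k × IsCyclicShift (extLeafLengths (tree e)) μ
  tree-shape {e} e∈ = leaves≡k , shift e , shift<|μ| , extLeafLengths-tree
    where
    open Weight e∈
    leaves≡k : leavesL (decode (code e)) ≡ k
    leaves≡k = begin
      leavesL (decode (code e))        ≡⟨ sym (length-extL (decode (code e))) ⟩
      length (extLeafLengths (tree e)) ≡⟨ cong length extLeafLengths-tree ⟩
      length (rotate (shift e) μ)      ≡⟨ length-rotate (shift e) μ (<⇒≤ shift<|μ|) ⟩
      length μ                         ≡⟨ |μ| ⟩
      k                                ∎
      where open ≡-Reasoning

  tree-injective : ∀ {e e′} → e ∈ weights → e′ ∈ weights → tree e ≡ tree e′ → e ≡ e′
  tree-injective {e} {e′} e∈ e′∈ trees≡ = begin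
    e                                  ≡⟨ sym W.second ⟩
    map proj₂ (zip μ e)                ≡⟨ cong (map proj₂) W.zip-from-code ⟩
    map proj₂ (rotate (k ∸ shift e) (code e))
      ≡⟨ cong₂ (λ s w → map proj₂ (rotate (k ∸ s) w)) shifts≡ codes≡ ⟩
    map proj₂ (rotate (k ∸ shift e′) (code e′))
                                       ≡⟨ cong (map proj₂) (sym W′.zip-from-code) ⟩
    map proj₂ (zip μ e′)               ≡⟨ W′.second ⟩
    e′                                 ∎
    where
    open ≡-Reasoning
    module W  = Weight e∈
    module W′ = Weight e′∈
    node-injective : ∀ {cs cs′} → node cs ≡ node cs′ → cs ≡ cs′
    node-injective refl = refl
    codes≡ : code e ≡ code e′
    codes≡ = trans (sym (encode-decode W.good)) (trans (cong encode (node-injective trees≡)) (encode-decode W′.good))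
    coprime : Coprime (length μ) (sum μ)
    coprime = subst₂ Coprime (sym |μ|) (sym Σμ) (coprime-n-2n+1 k)
    shifts≡ : shift e ≡ shift e′
    shifts≡ = rotate-injective μ coprime W.shift<|μ| W′.shift<|μ|
                (trans (sym W.map-proj₁-code) (trans (cong (map proj₁) codes≡) W′.map-proj₁-code))

  module Unrotate {s w} (s<|μ| : s < length μ) (good : Good 0 w) (first-w : map proj₁ w ≡ rotate s μ) where
    s≤|μ| : s ≤ length μ
    s≤|μ| = <⇒≤ s<|μ|

    |w| : length w ≡ length μ
    |w| = trans (sym (length-map proj₁ w)) (trans (cong length first-w) (length-rotate s μ s≤|μ|))

    e : List ℕ
    e = map proj₂ (rotate (length μ ∸ s) w)

    zip≡ : zip μ e ≡ rotate (length μ ∸ s) w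
    zip≡ = trans (cong (λ xs → zip xs e) (sym first)) (zip-map-proj (rotate (length μ ∸ s) w))
      where
      open ≡-Reasoning
      first : map proj₁ (rotate (length μ ∸ s) w) ≡ μ
      first = begin
        map proj₁ (rotate (length μ ∸ s) w) ≡⟨ map-rotate proj₁ (length μ ∸ s) w ⟩
        rotate (length μ ∸ s) (map proj₁ w) ≡⟨ cong (rotate (length μ ∸ s)) first-w ⟩
        rotate (length μ ∸ s) (rotate s μ)  ≡⟨ rotate-∸-rotate s μ s≤|μ| ⟩
        μ                                   ∎

    rotate-zip : rotate s (zip μ e) ≡ w
    rotate-zip = trans (cong (rotate s) zip≡)
      (subst (λ n → rotate s (rotate (n ∸ s) w) ≡ w) |w| (rotate-rotate-∸ s w (subst (s ≤_) (sym |w|) s≤|μ|)))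

    e∈ : e ∈ weights
    e∈ = ∈-compositions⁺ _ k
      ( trans (length-map proj₂ (rotate (length μ ∸ s) w))
              (trans (length-rotate (length μ ∸ s) w (subst (length μ ∸ s ≤_) (sym |w|) (m∸n≤m (length μ) s)))
                     (trans |w| |μ|))
      , subst Positive (sym (map-rotate proj₂ (length μ ∸ s) w)) (All-rotate (length μ ∸ s) (Good-positive good))
      , trans (sum-map-rotate proj₂ (length μ ∸ s) w)
              (trans (Good-balance good) (cong suc (trans (cong sum first-w) (trans (sum-rotate s μ) Σμ)))) )

  code-surjective : ∀ {s w} → s < length μ → Good 0 w → map proj₁ w ≡ rotate s μ → ∃ λ e → e ∈ weights × code e ≡ w
  code-surjective {s} {w} s<|μ| good first-w = e , e∈ , trans (cong (λ n → rotate n (zip μ e)) shift≡s) rotate-zip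
    where
    open Unrotate s<|μ| good first-w
    shift≡s : shift e ≡ s
    shift≡s = sym (dominated⇒≡cycleShift (zip μ e) (Weight.balanced e∈)
                    (subst (s <_) (trans |μ| (sym (Weight.|zip| e∈))) s<|μ|)
                    (subst (Dominated 0) (sym rotate-zip) (Good⇒Dominated good)))

  tree-surjective : 1 ≤ k → ∀ T → IsCyclicShift (extLeafLengths T) μ → ∃ λ e → e ∈ weights × T ≡ tree e
  tree-surjective k≥1 (node []) (s , s<|μ| , []≡) =
    ⊥-elim (<⇒≢ k≥1 (trans (trans (cong length []≡) (length-rotate s μ (<⇒≤ s<|μ|))) |μ|))
  tree-surjective _ (node (c ∷ cs)) (s , s<|μ| , ext≡)
    with code-surjective s<|μ| (encode-Good c cs) (trans (map-proj₁-encode (c ∷ cs)) ext≡)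
  ... | e , e∈ , code≡ = e , e∈ , cong node (trans (sym (decode-encode (c ∷ cs))) (cong decode (sym code≡)))

lemma4p4 : (k : ℕ) → 1 ≤ k → (μ : List ℕ) →
    length μ ≡ k → All (λ m → 1 ≤ m) μ → sum μ ≡ 2 * k + 1 →
    ∃ λ (L : List PTree) → Unique L
      × (∀ T → (T ∈ L) ⇔ (leaves T ≡ k × IsCyclicShift (extLeafLengths T) μ))
      × length L ≡ (2 * k + 1) C (k ∸ 1)
lemma4p4 k@(suc k′) k≥1 μ |μ| μ-positive Σμ =
  map tree weights ,
  Unique-map⁺ tree tree-injective (compositions-unique (suc (2 * k + 1)) k) ,
  (λ T → mk⇔ (listed⇒shape T) (shape⇒listed T)) ,
  trans (length-map tree weights) (length-compositions (2 * k + 1) k′)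
  where
  open Counting k μ |μ| μ-positive Σμ
  listed⇒shape : ∀ T → T ∈ map tree weights → leaves T ≡ k × IsCyclicShift (extLeafLengths T) μ
  listed⇒shape T T∈ with ∈-map⁻ tree T∈
  ... | e , e∈ , refl = tree-shape e∈
  shape⇒listed : ∀ T → leaves T ≡ k × IsCyclicShift (extLeafLengths T) μ → T ∈ map tree weights
  shape⇒listed T (_ , cyclic) with tree-surjective k≥1 T cyclic
  ... | e , e∈ , refl = ∈-map⁺ tree e∈
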